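{- For every dialogue tree $d\in\mathcal{D}_{\mathbb N}\mathbb{N}$ and every sequence $\alpha:\mathbb{N}\to\mathbb{N}$, we have $\mathsf{maxQ}\,d\,\alpha=[\![\mathsf{maxQ}^T]\!]\,(\mathsf{enc}_\iota\,d)\,\alpha$.
   Context: Metatheory: constructive Martin-Löf type theory without function extensionality. System T types: base $\iota$ and $\sigma\Rightarrow\tau$; standard terms ($\mathsf{zero}$, $\mathsf{succ}$, $\mathsf{rec}$, $\lambda$, application) and set interpretation $[\![\iota]\!]=\mathbb{N}$, $[\![\sigma\Rightarrow\tau]\!]=[\![\sigma]\!]\to[\![\tau]\!]$, $[\![\mathsf{zero}]\!]=0$. Dialogue trees $\mathcal{D}_{\mathbb N}\mathbb{N}$: inductive, constructors $\eta\,n$ and $\beta\,\varphi\,i$. $\mathsf{maxQ}(\eta\,n)\,\alpha=0$, $\mathsf{maxQ}(\beta\,\varphi\,n)\,\alpha=\max(n,\mathsf{maxQ}(\varphi(\alpha\,n))\,\alpha)$. Internal trees: $\mathsf{ChD}_A(\sigma):=(\sigma\Rightarrow A)\Rightarrow((\iota\Rightarrow A)\Rightarrow\iota\Rightarrow A)\Rightarrow A$; $\eta_A:=\lambda z\,e\,b.\,e\,z$; $\beta_A:=\lambda\varphi\,x\,e\,b.\,b(\lambda y.\varphi\,y\,e\,b)\,x$. Encoding $\mathsf{enc}_A(\eta\,z)=[\![\eta_A]\!]z$, $\mathsf{enc}_A(\beta\,\varphi\,x)=[\![\beta_A]\!](\mathsf{enc}_A\circ\varphi)\,x$. Fix a closed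 term $\mathsf{max}^T:\iota\Rightarrow\iota\Rightarrow\iota$ with $[\![\mathsf{max}^T]\!]\,a\,b=\max(a,b)$, and let $\mathsf{maxQ}^T:=\lambda d\,\alpha.\,d\,(\lambda w.\mathsf{zero})\,(\lambda g\,x.\,\mathsf{max}^T\,x\,(g\,(\alpha\,x)))$ of type $\mathsf{ChD}_\iota(\iota)\Rightarrow(\iota\Rightarrow\iota)\Rightarrow\iota$. -}

module Defs where

open import Data.Nat using (ℕ; zero; suc; _⊔_)
open import Data.List using (List; []; _∷_)

data Ty : Set where
  ι   : Ty
  _⇒_ : Ty → Ty → Ty

infixr 7 _⇒_

Cxt : Set
Cxt = List Ty

data _∈_ (σ : Ty) : Cxt → Set where
  here  : ∀ {Γ} → σ ∈ (σ ∷ Γ)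
  there : ∀ {τ Γ} → σ ∈ Γ → σ ∈ (τ ∷ Γ)

data Tm (Γ : Cxt) : Ty → Set where
  Zero : Tm Γ ι
  Succ : Tm Γ (ι ⇒ ι)
  Rec  : ∀ {σ} → Tm Γ ((ι ⇒ σ ⇒ σ) ⇒ σ ⇒ ι ⇒ σ)
  var  : ∀ {σ} → σ ∈ Γ → Tm Γ σ
  lam  : ∀ {σ τ} → Tm (σ ∷ Γ) τ → Tm Γ (σ ⇒ τ)
  _·_  : ∀ {σ τ} → Tm Γ (σ ⇒ τ) → Tm Γ σ → Tm Γ τ

infixl 6 _·_

⟦_⟧ty : Ty → Set
⟦ ι ⟧ty = ℕ
⟦ σ ⇒ τ ⟧ty = ⟦ σ ⟧ty → ⟦ τ ⟧ty

data Env : Cxt → Set where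
  ε   : Env []
  _,,_ : ∀ {σ Γ} → ⟦ σ ⟧ty → Env Γ → Env (σ ∷ Γ)

lookupEnv : ∀ {Γ σ} → Env Γ → σ ∈ Γ → ⟦ σ ⟧ty
lookupEnv (x ,, ρ) here = x
lookupEnv (x ,, ρ) (there i) = lookupEnv ρ i

rec : ∀ {A : Set} → (ℕ → A → A) → A → ℕ → A
rec f a zero = a
rec f a (suc n) = f n (rec f a n)

⟦_⟧ₑ : ∀ {Γ σ} → Tm Γ σ → Env Γ → ⟦ σ ⟧ty
⟦ Zero ⟧ₑ ρ = zero
⟦ Succ ⟧ₑ ρ = suc
⟦ Rec ⟧ₑ ρ = rec
⟦ var i ⟧ₑ ρ = lookupEnv ρ i
⟦ lam t ⟧ₑ ρ = λ x → ⟦ t ⟧ₑ (x ,, ρ)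
⟦ t · u ⟧ₑ ρ = ⟦ t ⟧ₑ ρ (⟦ u ⟧ₑ ρ)

⟦_⟧ : ∀ {σ} → Tm [] σ → ⟦ σ ⟧ty
⟦ t ⟧ = ⟦ t ⟧ₑ ε

data D : Set where
  η : ℕ → D
  β : (ℕ → D) → ℕ → D

maxQ : D → (ℕ → ℕ) → ℕ
maxQ (η n) α = 0
maxQ (β φ n) α = n ⊔ maxQ (φ (α n)) α

-- internal (Church-encoded) trees
ChD : Ty → Ty → Ty
ChD A σ = (σ ⇒ A) ⇒ ((ι ⇒ A) ⇒ ι ⇒ A) ⇒ A

v0 : ∀ {Γ σ} → σ ∈ (σ ∷ Γ)
v0 = here
v1 : ∀ {Γ σ τ} → σ ∈ (τ ∷ σ ∷ Γ)
v1 = there here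
v2 : ∀ {Γ σ τ ρ} → σ ∈ (ρ ∷ τ ∷ σ ∷ Γ)
v2 = there (there here)
v3 : ∀ {Γ σ τ ρ μ} → σ ∈ (μ ∷ ρ ∷ τ ∷ σ ∷ Γ)
v3 = there (there (there here))
v4 : ∀ {Γ σ τ ρ μ ν} → σ ∈ (ν ∷ μ ∷ ρ ∷ τ ∷ σ ∷ Γ)
v4 = there (there (there (there here)))

-- η_A := λ z e b. e z
ηT : (A : Ty) → Tm [] (ι ⇒ ChD A ι)
ηT A = lam (lam (lam (var v1 · var v2)))

-- β_A := λ φ x e b. b (λ y. φ y e b) x
βT : (A : Ty) → Tm [] ((ι ⇒ ChD A ι) ⇒ ι ⇒ ChD A ι)
βT A = lam (lam (lam (lam
  (var v0 · lam (var v4 · var v0 · var v2 · var v1) · var v2))))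

enc : (A : Ty) → D → ⟦ ChD A ι ⟧ty
enc A (η z) = ⟦ ηT A ⟧ z
enc A (β φ x) = ⟦ βT A ⟧ (λ n → enc A (φ n)) x

rename : ∀ {Γ Δ σ} → (∀ {τ} → τ ∈ Γ → τ ∈ Δ) → Tm Γ σ → Tm Δ σ
rename r Zero = Zero
rename r Succ = Succ
rename r Rec = Rec
rename r (var i) = var (r i)
rename r (lam t) = lam (rename (λ { here → here ; (there i) → there (r i) }) t)
rename r (t · u) = rename r t · rename r u

weaken : ∀ {Γ σ} → Tm [] σ → Tm Γ σ
weaken = rename (λ ())

-- maxQ^T := λ d α. d (λ w. zero) (λ g x. max^T x (g (α x))),
-- parameterised by the closed term max^T
maxQT : Tm [] (ι ⇒ ι ⇒ ι) → Tm [] (ChD ι ι ⇒ (ι ⇒ ι) ⇒ ι)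
maxQT m = lam (lam (var v1 · lam Zero
  · lam (lam (weaken m · var v0 · (var v1 · (var v2 · var v0))))))

-- The encoding interprets β as b (λ y. φ y e b) x, so evaluating enc ι d at a leaf case e
-- and a branch case b is the fold of d by e and b; maxQ is exactly such a fold with e ≡ 0
-- and b g x ≡ max x (g (α x)).  The only obstacle is that maxQ^T mentions max^T weakened
-- into a non-empty context, and without function extensionality its meaning there is only
-- extensionally equal to ⟦ max^T ⟧; a logical relation for renaming bridges that gap.
module Submission where

open import Defs
open import Data.Nat using (ℕ; zero; suc; _⊔_)
open import Data.List using ([])
open import Relation.Binary.PropositionalEquality using (_≡_; refl; cong; sym; trans)

Ext : (σ : Ty) → ⟦ σ ⟧ty → ⟦ σ ⟧ty → Set
Ext ι x y = x ≡ y
Ext (σ ⇒ τ) f g = ∀ {a b} → Ext σ a b → Ext τ (f a) (g b)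

rec-Ext : ∀ σ {f g : ℕ → ⟦ σ ⟧ty → ⟦ σ ⟧ty} {a b : ⟦ σ ⟧ty}
  → Ext (ι ⇒ σ ⇒ σ) f g → Ext σ a b → ∀ n → Ext σ (rec f a n) (rec g b n)
rec-Ext σ f≈g a≈b zero = a≈b
rec-Ext σ f≈g a≈b (suc n) = f≈g refl (rec-Ext σ f≈g a≈b n)

Renaming : Cxt → Cxt → Set
Renaming Γ Δ = ∀ {τ} → τ ∈ Γ → τ ∈ Δ

EnvExt : ∀ {Γ Δ} → Renaming Γ Δ → Env Γ → Env Δ → Set
EnvExt {Γ} r ρ ρ′ = ∀ {τ} (i : τ ∈ Γ) → Ext τ (lookupEnv ρ i) (lookupEnv ρ′ (r i))

rename-Ext : ∀ {Γ Δ σ} (r : Renaming Γ Δ) (t : Tm Γ σ) {ρ : Env Γ} {ρ′ : Env Δ}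
  → EnvExt r ρ ρ′ → Ext σ (⟦ t ⟧ₑ ρ) (⟦ rename r t ⟧ₑ ρ′)
rename-Ext r Zero ρ≈ρ′ = refl
rename-Ext r Succ ρ≈ρ′ = cong suc
rename-Ext r (Rec {σ}) ρ≈ρ′ = λ { f≈g a≈b {n} refl → rec-Ext σ f≈g a≈b n }
rename-Ext r (var i) ρ≈ρ′ = ρ≈ρ′ i
rename-Ext r (lam t) ρ≈ρ′ = λ a≈b → rename-Ext _ t λ { here → a≈b ; (there i) → ρ≈ρ′ i }
rename-Ext r (t · u) ρ≈ρ′ = rename-Ext r t ρ≈ρ′ (rename-Ext r u ρ≈ρ′)

weaken-Ext : ∀ {Γ σ} (t : Tm [] σ) (ρ : Env Γ) → Ext σ ⟦ t ⟧ (⟦ weaken t ⟧ₑ ρ)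
weaken-Ext t ρ = rename-Ext (λ ()) t (λ ())

maxQ≡enc-fold : (α : ℕ → ℕ) {e : ℕ → ℕ} {b : (ℕ → ℕ) → ℕ → ℕ}
  → (∀ x → e x ≡ 0) → (∀ g x → b g x ≡ x ⊔ g (α x))
  → (d : D) → maxQ d α ≡ enc ι d e b
maxQ≡enc-fold α e≡0 b≡max (η n) = sym (e≡0 n)
maxQ≡enc-fold α e≡0 b≡max (β φ n) =
  trans (cong (n ⊔_) (maxQ≡enc-fold α e≡0 b≡max (φ (α n)))) (sym (b≡max _ n))

lemma40 : (maxT : Tm [] (ι ⇒ ι ⇒ ι))
    → (∀ a b → ⟦ maxT ⟧ a b ≡ a ⊔ b)
    → (d : D) (α : ℕ → ℕ)
    → maxQ d α ≡ ⟦ maxQT maxT ⟧ (enc ι d) α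
lemma40 maxT maxT≡⊔ d α =
  maxQ≡enc-fold α (λ _ → refl) (λ g x → trans (sym (weaken-Ext maxT _ refl refl)) (maxT≡⊔ x _)) d
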